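{- Let $k$ be a positive integer, let $G_1,G_2$ be disjoint copies of $C_{3k+2}$, and let $f:V(G_1)\to V(G_2)$ be any function. Then $\gamma(C(C_{3k+2},f))<2\gamma(C_{3k+2})$.
   Context: For disjoint copies $G_1,G_2$ of a graph $G$ and a function $f:V(G_1)\to V(G_2)$, the functigraph $C(G,f)$ has vertex set $V(G_1)\cup V(G_2)$ and edge set $E(G_1)\cup E(G_2)\cup\{uv : u\in V(G_1), v\in V(G_2), v=f(u)\}$. $\gamma$ denotes domination number. -}

module Defs where

open import Data.Nat using (ℕ; NonZero; zero; suc; _+_; _*_; _≤_; _<_)
open import Data.Fin using (Fin; toℕ)
open import Data.Fin.Properties using ()
open import Data.Sum using (_⊎_; inj₁; inj₂)
open import Data.Product using (Σ; _×_; ∃; ∃-syntax; _,_)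
open import Data.List using (List; length)
open import Data.List.Membership.Propositional using (_∈_)
open import Data.List.Relation.Unary.Unique.Propositional using (Unique)
open import Data.Nat.DivMod using (_%_)
open import Relation.Binary.PropositionalEquality using (_≡_)
open import Data.Empty using (⊥)

record Graph (V : Set) : Set₁ where
  field
    Adj : V → V → Set

open Graph public

-- The cycle C_n on vertices 0..n-1 (intended for n ≥ 3):
-- i ~ j iff j ≡ i+1 (mod n) or i ≡ j+1 (mod n).
Cycle : (n : ℕ) → .{{NonZero n}} → Graph (Fin n)
Adj (Cycle n) i j =
  (toℕ j ≡ (suc (toℕ i)) % n) ⊎ (toℕ i ≡ (suc (toℕ j)) % n)

-- Functigraph C(G,f): vertex set V(G₁) ⊎ V(G₂) (two disjoint copies),
-- edges of G in each copy, plus u₁ — f(u)₂ for u ∈ V(G₁) (in either direction).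
Functigraph : {V : Set} → Graph V → (V → V) → Graph (V ⊎ V)
Adj (Functigraph G f) (inj₁ u) (inj₁ v) = Adj G u v
Adj (Functigraph G f) (inj₂ u) (inj₂ v) = Adj G u v
Adj (Functigraph G f) (inj₁ u) (inj₂ v) = v ≡ f u
Adj (Functigraph G f) (inj₂ v) (inj₁ u) = v ≡ f u

Dominating : {V : Set} → Graph V → List V → Set
Dominating {V} G D = (v : V) → (v ∈ D) ⊎ (∃[ u ] (u ∈ D × Adj G u v))

IsDominationNumber : {V : Set} → Graph V → ℕ → Set
IsDominationNumber {V} G m =
  (∃[ D ] (Unique D × Dominating G D × length D ≡ m))
  × ((D : List V) → Unique D → Dominating G D → m ≤ length D)

module Submission where

-- Each vertex of C_{3k+2} dominates three vertices, so γ(C_{3k+2}) ≥ k + 1, and it suffices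
-- to dominate the functigraph with k + (k + 1) vertices. Measure positions by forward distance
-- along the cycle. In G₁ the k vertices at distances 2, 5, …, 3b − 1, 3b + 3, …, 3k from x
-- dominate everything except x and x + 3b + 1, whose images must then lie in the G₂-part. In G₂
-- the k + 1 vertices at distances 2, 5, …, 3b − 1, 3b, 3b + 3, …, 3k from z dominate everything
-- except z (nothing is missed when b = 0), and z is dominated if it is an image of the G₁-part.
-- Write p ∼ q when the forward distance from p to q is ≡ 1 (mod 3); as 3k + 2 ≡ 2 this relation
-- is symmetric and triangle-free. If p ≁ q, both lie at distances ≡ 0 from p or from q, so when
-- f(x) ≁ f(x + 3b + 1) for some x and b ∈ {0, 1}, both images lie in a G₂-part with b = 0.
-- Otherwise f(c), …, f(c + 4), f(c) is a closed ∼-walk, hence z = f(c + 3) is related to neither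
-- f(c) nor f(c + 1); these two sit at distances ≡ 2 and ≡ 0 from z, inside the G₂-part for a
-- suitable b, and z is the image of c + 3, which lies in the G₁-part for b = 0.

open import Defs
open import Data.Empty using (⊥-elim)
open import Data.Fin as Fin using (Fin; toℕ; fromℕ<; combine; remQuot)
open import Data.Fin.Properties using (toℕ-fromℕ<; toℕ-injective; toℕ<n; injective⇒≤; remQuot-combine)
  renaming (_≟_ to _≟ᶠ_)
open import Data.List using (List; []; _∷_; length; map; _++_; deduplicate; lookup)
open import Data.List.Membership.Propositional using (_∈_; find)
open import Data.List.Membership.Propositional.Properties
  using (∈-map⁺; ∈-map⁻; ∈-++⁺ˡ; ∈-++⁺ʳ; ∈-deduplicate⁺)
open import Data.List.Properties using (length-deduplicate; length-++; length-map)
open import Data.List.Relation.Unary.Any using (Any; here; there; index)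
open import Data.List.Relation.Unary.Any.Properties using (++⁺ˡ; ++⁺ʳ; lookup-index)
open import Data.List.Relation.Unary.Unique.DecPropositional.Properties using (deduplicate-!)
open import Data.Nat as ℕ
  using (ℕ; zero; suc; _+_; _*_; _∸_; _≤_; _<_; z≤n; s≤s; NonZero; >-nonZero⁻¹; pred; _≤?_; _<?_)
open import Data.Nat.DivMod
  using (_%_; _/_; %-distribˡ-+; [m+kn]%n≡m%n; [m+n]%n≡m%n; m%n%n≡m%n; m%n<n; n%n≡0; m<n⇒m%n≡m;
         m≤n⇒[n∸m]%m≡n%m; m≡m%n+[m/n]*n; m<n*o⇒m/o<n)
open import Data.Nat.Properties
open import Data.Nat.Tactic.RingSolver using (solve-∀)
open import Data.Product using (Σ; _×_; _,_; ∃-syntax)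
open import Data.Sum as Sum using (_⊎_; inj₁; inj₂; swap)
open import Data.Sum.Properties using (≡-dec)
open import Function using (_∘_)
open import Relation.Binary.Definitions using (DecidableEquality; tri<; tri≈; tri>)
open import Relation.Binary.PropositionalEquality
  using (_≡_; _≢_; refl; sym; trans; cong; cong₂; subst; subst₂; module ≡-Reasoning)
open import Relation.Nullary using (¬_; Dec; yes; no)

open ≡-Reasoning

infix 4 _≡_mod_

_≡_mod_ : ℕ → ℕ → (d : ℕ) → .{{NonZero d}} → Set
_≡_mod_ x y d = x % d ≡ y % d

module _ {d : ℕ} .{{_ : NonZero d}} where

  +-cong-mod : ∀ {x y u v} → x ≡ y mod d → u ≡ v mod d → x + u ≡ y + v mod d
  +-cong-mod {x} {y} {u} {v} x≡y u≡v = begin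
    (x + u) % d          ≡⟨ %-distribˡ-+ x u d ⟩
    (x % d + u % d) % d  ≡⟨ cong₂ (λ p q → (p + q) % d) x≡y u≡v ⟩
    (y % d + v % d) % d  ≡⟨ %-distribˡ-+ y v d ⟨
    (y + v) % d          ∎

  %-absorb : ∀ x → x % d ≡ x mod d
  %-absorb x = m%n%n≡m%n x d

  +-cancelˡ-mod : ∀ a {b c} → a + b ≡ a + c mod d → b ≡ c mod d
  +-cancelˡ-mod a {b} {c} a+b≡a+c = begin
    b % d                       ≡⟨ [m+kn]%n≡m%n b a d ⟨
    (b + a * d) % d             ≡⟨ cong (_% d) (rearrange b) ⟩
    (a * pred d + (a + b)) % d  ≡⟨ +-cong-mod {x = a * pred d} refl a+b≡a+c ⟩
    (a * pred d + (a + c)) % d  ≡⟨ cong (_% d) (rearrange c) ⟨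
    (c + a * d) % d             ≡⟨ [m+kn]%n≡m%n c a d ⟩
    c % d                       ∎
    where
    identity : ∀ x a p → x + a * suc p ≡ a * p + (a + x)
    identity = solve-∀
    rearrange : ∀ x → x + a * d ≡ a * pred d + (a + x)
    rearrange x = trans (cong (λ m → x + a * m) (sym (suc-pred d))) (identity x a (pred d))

≢1⇒≡0⊎≡2 : ∀ {x} → ¬ x ≡ 1 mod 3 → x ≡ 0 mod 3 ⊎ x ≡ 2 mod 3
≢1⇒≡0⊎≡2 {x} x≢1 with x % 3 | m%n<n x 3
... | 0 | _ = inj₁ refl
... | 1 | _ = ⊥-elim (x≢1 refl)
... | 2 | _ = inj₂ refl
... | suc (suc (suc _)) | s≤s (s≤s (s≤s ()))

m<n+n⇒m≡m%n⊎m≡n+m%n : ∀ {m n} .{{_ : NonZero n}} → m < n + n → m ≡ m % n ⊎ m ≡ n + m % n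
m<n+n⇒m≡m%n⊎m≡n+m%n {m} {n} m<n+n with m <? n
... | yes m<n = inj₁ (sym (m<n⇒m%n≡m m<n))
... | no m≮n = inj₂ (begin
  m                ≡⟨ m+[n∸m]≡n n≤m ⟨
  n + (m ∸ n)      ≡⟨ cong (n +_) (m<n⇒m%n≡m m∸n<n) ⟨
  n + (m ∸ n) % n  ≡⟨ cong (n +_) (m≤n⇒[n∸m]%m≡n%m n≤m) ⟩
  n + m % n        ∎)
  where
  n≤m : n ≤ m
  n≤m = ≮⇒≥ m≮n
  m∸n<n : m ∸ n < n
  m∸n<n = +-cancelˡ-< n (m ∸ n) n (subst (_< n + n) (sym (m+[n∸m]≡n n≤m)) m<n+n)

data Near : ℕ → ℕ → Set where
  same : ∀ {e} → Near e e
  next : ∀ {e} → Near (suc e) e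
  prev : ∀ {e} → Near e (suc e)

Covered : List ℕ → ℕ → Set
Covered L e = Any (λ x → Near x e) L

near-suc : ∀ {x e} → Near x e → Near (suc x) (suc e)
near-suc same = same
near-suc next = next
near-suc prev = prev

near : ∀ a e → a ≤ suc e → suc e < a + 3 → Near a e
near zero zero _ _ = same
near zero (suc zero) _ _ = prev
near zero (suc (suc e)) _ (s≤s (s≤s (s≤s ())))
near (suc zero) zero _ _ = next
near (suc (suc a)) zero (s≤s ()) _
near (suc a) (suc e) (s≤s a≤1+e) (s≤s 2+e<a+3) = near-suc (near a e a≤1+e 2+e<a+3)

progression : ℕ → ℕ → List ℕ
progression a zero = []
progression a (suc m) = a ∷ progression (a + 3) m

length-progression : ∀ a m → length (progression a m) ≡ m
length-progression a zero = refl
length-progression a (suc m) = cong suc (length-progression (a + 3) m)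

∈-progression : ∀ a {m i} → i < m → a + i * 3 ∈ progression a m
∈-progression a {suc m} {zero} _ = here (+-identityʳ a)
∈-progression a {suc m} {suc i} (s≤s i<m) =
  there (subst (_∈ progression (a + 3) m) (+-assoc a 3 (i * 3)) (∈-progression (a + 3) i<m))

progression-covers : ∀ a m e → a ≤ suc e → suc e < a + m * 3 → Covered (progression a m) e
progression-covers a zero e a≤1+e 1+e<a = ⊥-elim (<⇒≱ (subst (suc e <_) (+-identityʳ a) 1+e<a) a≤1+e)
progression-covers a (suc m) e a≤1+e 1+e<end with suc e <? a + 3
... | yes 1+e<a+3 = here (near a e a≤1+e 1+e<a+3)
... | no 1+e≮a+3 = there (progression-covers (a + 3) m e (≮⇒≥ 1+e≮a+3)
                            (subst (suc e <_) (sym (+-assoc a 3 (m * 3))) 1+e<end))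

offsets₁ offsets₂ : ℕ → ℕ → List ℕ
offsets₁ b c = progression 2 b ++ progression (suc b * 3) c
offsets₂ b c = progression 2 b ++ progression (b * 3) (suc c)

length-offsets₁ : ∀ b c → length (offsets₁ b c) ≡ b + c
length-offsets₁ b c =
  trans (length-++ (progression 2 b)) (cong₂ _+_ (length-progression 2 b) (length-progression _ c))

length-offsets₂ : ∀ b c → length (offsets₂ b c) ≡ b + suc c
length-offsets₂ b c =
  trans (length-++ (progression 2 b))
        (cong₂ _+_ (length-progression 2 b) (length-progression _ (suc c)))

offsets₁-covers : ∀ b c e → 0 < e → e < 2 + (b + c) * 3 → e ≢ suc (b * 3) → Covered (offsets₁ b c) e
offsets₁-covers b c e 0<e e<end e≢hole with <-cmp e (suc (b * 3))
... | tri< e<hole _ _ = ++⁺ˡ (progression-covers 2 b e (s≤s 0<e) (s≤s e<hole))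
... | tri≈ _ e≡hole _ = ⊥-elim (e≢hole e≡hole)
... | tri> _ _ hole<e = ++⁺ʳ (progression 2 b) (progression-covers (suc b * 3) c e (s≤s hole<e)
                          (subst (λ t → suc e < 3 + t) (*-distribʳ-+ 3 b c) (s≤s e<end)))

offsets₂-covers : ∀ b c e → 0 < e ⊎ b ≡ 0 → e < 2 + (b + c) * 3 → Covered (offsets₂ b c) e
offsets₂-covers b c e 0<e⊎b≡0 e<end with b * 3 ≤? suc e
... | yes start≤ = ++⁺ʳ (progression 2 b) (progression-covers (b * 3) (suc c) e start≤
                          (subst (suc e <_) (identity b c) (s≤s e<end)))
  where
  identity : ∀ b c → 3 + (b + c) * 3 ≡ b * 3 + suc c * 3
  identity = solve-∀
... | no start≰ =
  ++⁺ˡ (progression-covers 2 b e (2≤1+e 0<e⊎b≡0) (<-≤-trans 1+e<start (m≤n+m (b * 3) 2)))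
  where
  1+e<start : suc e < b * 3
  1+e<start = ≰⇒> start≰
  2≤1+e : 0 < e ⊎ b ≡ 0 → 2 ≤ suc e
  2≤1+e (inj₁ 0<e) = s≤s 0<e
  2≤1+e (inj₂ b≡0) = ⊥-elim (n≮0 (subst (λ t → suc e < t * 3) b≡0 1+e<start))

DominatedBy : {V : Set} → Graph V → List V → V → Set
DominatedBy G D v = v ∈ D ⊎ ∃[ u ] (u ∈ D × Adj G u v)

module CycleArithmetic (n : ℕ) .{{_ : NonZero n}} where

  _⊕_ : Fin n → ℕ → Fin n
  x ⊕ e = fromℕ< (m%n<n (toℕ x + e) n)

  toℕ-⊕ : ∀ x e → toℕ (x ⊕ e) ≡ (toℕ x + e) % n
  toℕ-⊕ x e = toℕ-fromℕ< _

  toℕ%n : ∀ x → toℕ x % n ≡ toℕ x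
  toℕ%n x = m<n⇒m%n≡m (toℕ<n x)

  ⊕-assoc : ∀ x a b → (x ⊕ a) ⊕ b ≡ x ⊕ (a + b)
  ⊕-assoc x a b = toℕ-injective (begin
    toℕ ((x ⊕ a) ⊕ b)          ≡⟨ toℕ-⊕ (x ⊕ a) b ⟩
    (toℕ (x ⊕ a) + b) % n      ≡⟨ cong (λ y → (y + b) % n) (toℕ-⊕ x a) ⟩
    ((toℕ x + a) % n + b) % n  ≡⟨ +-cong-mod (%-absorb (toℕ x + a)) refl ⟩
    (toℕ x + a + b) % n        ≡⟨ cong (_% n) (+-assoc (toℕ x) a b) ⟩
    (toℕ x + (a + b)) % n      ≡⟨ toℕ-⊕ x (a + b) ⟨
    toℕ (x ⊕ (a + b))          ∎)

  ⊕-identityʳ : ∀ x → x ⊕ 0 ≡ x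
  ⊕-identityʳ x = toℕ-injective (begin
    toℕ (x ⊕ 0)        ≡⟨ toℕ-⊕ x 0 ⟩
    (toℕ x + 0) % n    ≡⟨ cong (_% n) (+-identityʳ (toℕ x)) ⟩
    toℕ x % n          ≡⟨ toℕ%n x ⟩
    toℕ x              ∎)

  ⊕-n : ∀ x → x ⊕ n ≡ x
  ⊕-n x = toℕ-injective (trans (toℕ-⊕ x n) (trans ([m+n]%n≡m%n (toℕ x) n) (toℕ%n x)))

  δ : Fin n → Fin n → ℕ
  δ x v = (toℕ v + (n ∸ toℕ x)) % n

  δ<n : ∀ x v → δ x v < n
  δ<n x v = m%n<n _ n

  private
    +-∸-cancel : ∀ x y → toℕ x + y + (n ∸ toℕ x) ≡ y + n
    +-∸-cancel x y = begin
      toℕ x + y + (n ∸ toℕ x)    ≡⟨ cong (_+ (n ∸ toℕ x)) (+-comm (toℕ x) y) ⟩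
      y + toℕ x + (n ∸ toℕ x)    ≡⟨ +-assoc y (toℕ x) _ ⟩
      y + (toℕ x + (n ∸ toℕ x))  ≡⟨ cong (y +_) (m+[n∸m]≡n (<⇒≤ (toℕ<n x))) ⟩
      y + n                      ∎

  ⊕-δ : ∀ x v → x ⊕ δ x v ≡ v
  ⊕-δ x v = toℕ-injective (begin
    toℕ (x ⊕ δ x v)                       ≡⟨ toℕ-⊕ x (δ x v) ⟩
    (toℕ x + δ x v) % n                   ≡⟨ +-cong-mod {x = toℕ x} refl (%-absorb _) ⟩
    (toℕ x + (toℕ v + (n ∸ toℕ x))) % n   ≡⟨ cong (_% n) (+-assoc (toℕ x) (toℕ v) _) ⟨
    (toℕ x + toℕ v + (n ∸ toℕ x)) % n     ≡⟨ cong (_% n) (+-∸-cancel x (toℕ v)) ⟩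
    (toℕ v + n) % n                       ≡⟨ [m+n]%n≡m%n (toℕ v) n ⟩
    toℕ v % n                             ≡⟨ toℕ%n v ⟩
    toℕ v                                 ∎)

  δ-⊕ : ∀ x e → δ x (x ⊕ e) ≡ e % n
  δ-⊕ x e = begin
    (toℕ (x ⊕ e) + (n ∸ toℕ x)) % n      ≡⟨ cong (λ y → (y + (n ∸ toℕ x)) % n) (toℕ-⊕ x e) ⟩
    ((toℕ x + e) % n + (n ∸ toℕ x)) % n  ≡⟨ +-cong-mod (%-absorb (toℕ x + e)) refl ⟩
    (toℕ x + e + (n ∸ toℕ x)) % n        ≡⟨ cong (_% n) (+-∸-cancel x e) ⟩
    (e + n) % n                          ≡⟨ [m+n]%n≡m%n e n ⟩
    e % n                                ∎

  δ-self : ∀ x → δ x x ≡ 0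
  δ-self x = trans (cong (_% n) (m+[n∸m]≡n (<⇒≤ (toℕ<n x)))) (n%n≡0 n)

  ≡⇒δ≡0 : ∀ {x v} → x ≡ v → δ x v ≡ 0
  ≡⇒δ≡0 {x} refl = δ-self x

  δ≡0⇒≡ : ∀ {x v} → δ x v ≡ 0 → x ≡ v
  δ≡0⇒≡ {x} {v} δ≡0 = trans (sym (⊕-identityʳ x)) (trans (cong (x ⊕_) (sym δ≡0)) (⊕-δ x v))

  δ-additive : ∀ a b c → δ a b + δ b c ≡ δ a c ⊎ δ a b + δ b c ≡ n + δ a c
  δ-additive a b c =
    subst (λ t → δ a b + δ b c ≡ t ⊎ δ a b + δ b c ≡ n + t) (sym δ≡sum%n)
          (m<n+n⇒m≡m%n⊎m≡n+m%n (+-mono-< (δ<n a b) (δ<n b c)))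
    where
    δ≡sum%n : δ a c ≡ (δ a b + δ b c) % n
    δ≡sum%n = begin
      δ a c                        ≡⟨ cong (δ a) (trans (cong (_⊕ δ b c) (⊕-δ a b)) (⊕-δ b c)) ⟨
      δ a ((a ⊕ δ a b) ⊕ δ b c)    ≡⟨ cong (δ a) (⊕-assoc a (δ a b) (δ b c)) ⟩
      δ a (a ⊕ (δ a b + δ b c))    ≡⟨ δ-⊕ a _ ⟩
      (δ a b + δ b c) % n          ∎

  δ+δ≡n : ∀ {a b} → a ≢ b → δ a b + δ b a ≡ n
  δ+δ≡n {a} {b} a≢b with δ-additive a b a
  ... | inj₁ sum≡δaa = ⊥-elim (a≢b (δ≡0⇒≡ (m+n≡0⇒m≡0 (δ a b) (trans sum≡δaa (δ-self a)))))
  ... | inj₂ sum≡n+δaa = trans sum≡n+δaa (trans (cong (n +_) (δ-self a)) (+-identityʳ n))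

  Adj-⊕-suc : ∀ x e → Adj (Cycle n) (x ⊕ e) (x ⊕ suc e)
  Adj-⊕-suc x e = inj₁ (begin
    toℕ (x ⊕ suc e)            ≡⟨ toℕ-⊕ x (suc e) ⟩
    (toℕ x + suc e) % n        ≡⟨ cong (_% n) (+-suc (toℕ x) e) ⟩
    (1 + (toℕ x + e)) % n      ≡⟨ +-cong-mod {x = 1} refl (%-absorb (toℕ x + e)) ⟨
    suc ((toℕ x + e) % n) % n  ≡⟨ cong (λ y → suc y % n) (toℕ-⊕ x e) ⟨
    suc (toℕ (x ⊕ e)) % n      ∎)

  private
    successor : ∀ {x y} → toℕ y ≡ suc (toℕ x) % n → y ≡ x ⊕ 1
    successor {x} y≡1+x =
      toℕ-injective (trans y≡1+x (trans (cong (_% n) (+-comm 1 (toℕ x))) (sym (toℕ-⊕ x 1))))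

  Adj⇒⊕ : ∀ {u v} → Adj (Cycle n) u v → v ≡ u ⊕ 1 ⊎ v ≡ u ⊕ (n ∸ 1)
  Adj⇒⊕ (inj₁ v≡1+u) = inj₁ (successor v≡1+u)
  Adj⇒⊕ {u} {v} (inj₂ u≡1+v) = inj₂ (begin
    v                   ≡⟨ ⊕-n v ⟨
    v ⊕ n               ≡⟨ cong (v ⊕_) (m+[n∸m]≡n (>-nonZero⁻¹ n)) ⟨
    v ⊕ (1 + (n ∸ 1))   ≡⟨ ⊕-assoc v 1 (n ∸ 1) ⟨
    (v ⊕ 1) ⊕ (n ∸ 1)   ≡⟨ cong (_⊕ (n ∸ 1)) (successor u≡1+v) ⟨
    u ⊕ (n ∸ 1)         ∎)

  ⊕-dominates : ∀ c L v → Covered L (δ c v) → DominatedBy (Cycle n) (map (c ⊕_) L) v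
  ⊕-dominates c L v covered =
    subst (DominatedBy (Cycle n) (map (c ⊕_) L)) (⊕-δ c v) (from-near (find covered))
    where
    from-near : ∀ {e} → ∃[ x ] (x ∈ L × Near x e) → DominatedBy (Cycle n) (map (c ⊕_) L) (c ⊕ e)
    from-near (x , x∈L , same) = inj₁ (∈-map⁺ (c ⊕_) x∈L)
    from-near (x , x∈L , next) = inj₂ (c ⊕ x , ∈-map⁺ (c ⊕_) x∈L , swap (Adj-⊕-suc c _))
    from-near (x , x∈L , prev) = inj₂ (c ⊕ x , ∈-map⁺ (c ⊕_) x∈L , Adj-⊕-suc c x)

  ⊕-∈ : ∀ c L {v o} → δ c v ≡ o → o ∈ L → v ∈ map (c ⊕_) L
  ⊕-∈ c L {v} δ≡o o∈L =
    subst (_∈ map (c ⊕_) L) (trans (cong (c ⊕_) (sym δ≡o)) (⊕-δ c v)) (∈-map⁺ (c ⊕_) o∈L)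

  -- A vertex dominates only itself and its two neighbours, so recording which of the three
  -- a dominated vertex is, next to the index of its dominator, is injective.
  cycle-domination-≥ : (D : List (Fin n)) → Dominating (Cycle n) D → n ≤ length D * 3
  cycle-domination-≥ D dominating = injective⇒≤ {f = encode} encode-injective
    where
    neighbour : Fin n → Fin 3 → Fin n
    neighbour u Fin.zero = u
    neighbour u (Fin.suc Fin.zero) = u ⊕ 1
    neighbour u (Fin.suc (Fin.suc Fin.zero)) = u ⊕ (n ∸ 1)

    witness : ∀ v → DominatedBy (Cycle n) D v
            → Σ (Fin (length D)) λ i → Σ (Fin 3) λ o → neighbour (lookup D i) o ≡ v
    witness v (inj₁ v∈D) = index v∈D , Fin.zero , sym (lookup-index v∈D)
    witness v (inj₂ (u , u∈D , u~v)) with Adj⇒⊕ u~v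
    ... | inj₁ v≡u⊕1 =
      index u∈D , Fin.suc Fin.zero , trans (cong (_⊕ 1) (sym (lookup-index u∈D))) (sym v≡u⊕1)
    ... | inj₂ v≡u⊖1 = index u∈D , Fin.suc (Fin.suc Fin.zero) ,
                        trans (cong (_⊕ (n ∸ 1)) (sym (lookup-index u∈D))) (sym v≡u⊖1)

    encode : Fin n → Fin (length D * 3)
    encode v = let i , o , _ = witness v (dominating v) in combine i o

    decode : Fin (length D * 3) → Fin n
    decode w = let i , o = remQuot 3 w in neighbour (lookup D i) o

    decode-encode : ∀ v → decode (encode v) ≡ v
    decode-encode v with witness v (dominating v)
    ... | i , o , eq = trans (cong (λ (i , o) → neighbour (lookup D i) o) (remQuot-combine i o)) eq

    encode-injective : ∀ {x y} → encode x ≡ encode y → x ≡ y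
    encode-injective {x} {y} eq =
      trans (sym (decode-encode x)) (trans (cong decode eq) (decode-encode y))

domination-number-≤ : ∀ {V} {G : Graph V} {γ} → DecidableEquality V → IsDominationNumber G γ
                    → (D : List V) → Dominating G D → γ ≤ length D
domination-number-≤ {G = G} _≟_ (_ , minimum) D dominating =
  ≤-trans (minimum (deduplicate _≟_ D) (deduplicate-! _≟_ D) (dedup-dominating ∘ dominating))
          (length-deduplicate _≟_ D)
  where
  dedup-dominating : ∀ {v} → DominatedBy G D v → DominatedBy G (deduplicate _≟_ D) v
  dedup-dominating (inj₁ v∈D) = inj₁ (∈-deduplicate⁺ _≟_ v∈D)
  dedup-dominating (inj₂ (u , u∈D , u~v)) = inj₂ (u , ∈-deduplicate⁺ _≟_ u∈D , u~v)

functigraph-dominating : ∀ {V} (G : Graph V) (f : V → V) (D₁ D₂ : List V)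
  → (∀ v → DominatedBy G D₁ v ⊎ f v ∈ D₂)
  → (∀ w → DominatedBy G D₂ w ⊎ w ∈ map f D₁)
  → Dominating (Functigraph G f) (map inj₁ D₁ ++ map inj₂ D₂)
functigraph-dominating G f D₁ D₂ on-G₁ on-G₂ = dominated
  where
  in₁ : ∀ {u} → u ∈ D₁ → inj₁ u ∈ map inj₁ D₁ ++ map inj₂ D₂
  in₁ = ∈-++⁺ˡ ∘ ∈-map⁺ inj₁
  in₂ : ∀ {u} → u ∈ D₂ → inj₂ u ∈ map inj₁ D₁ ++ map inj₂ D₂
  in₂ = ∈-++⁺ʳ (map inj₁ D₁) ∘ ∈-map⁺ inj₂

  dominated : Dominating (Functigraph G f) (map inj₁ D₁ ++ map inj₂ D₂)
  dominated (inj₁ v) with on-G₁ v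
  ... | inj₁ (inj₁ v∈D₁) = inj₁ (in₁ v∈D₁)
  ... | inj₁ (inj₂ (u , u∈D₁ , u~v)) = inj₂ (inj₁ u , in₁ u∈D₁ , u~v)
  ... | inj₂ fv∈D₂ = inj₂ (inj₂ (f v) , in₂ fv∈D₂ , refl)
  dominated (inj₂ w) with on-G₂ w
  ... | inj₁ (inj₁ w∈D₂) = inj₁ (in₂ w∈D₂)
  ... | inj₁ (inj₂ (u , u∈D₂ , u~w)) = inj₂ (inj₂ u , in₂ u∈D₂ , u~w)
  ... | inj₂ w∈fD₁ = let u , u∈D₁ , w≡fu = ∈-map⁻ f w∈fD₁ in inj₂ (inj₁ u , in₁ u∈D₁ , w≡fu)

functigraph-domination-≤ : ∀ {V} → DecidableEquality V → (G : Graph V) (f : V → V) {γ : ℕ}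
  → IsDominationNumber (Functigraph G f) γ → (D₁ D₂ : List V)
  → (∀ v → DominatedBy G D₁ v ⊎ f v ∈ D₂)
  → (∀ w → DominatedBy G D₂ w ⊎ w ∈ map f D₁)
  → γ ≤ length D₁ + length D₂
functigraph-domination-≤ _≟_ G f isγ D₁ D₂ on-G₁ on-G₂ =
  ≤-trans (domination-number-≤ (≡-dec _≟_ _≟_) isγ _ (functigraph-dominating G f D₁ D₂ on-G₁ on-G₂))
          (≤-reflexive (trans (length-++ (map inj₁ D₁))
                              (cong₂ _+_ (length-map inj₁ D₁) (length-map inj₂ D₂))))

module Construction (k : ℕ) (f : Fin (2 + 3 * k) → Fin (2 + 3 * k)) where

  n : ℕ
  n = 2 + 3 * k

  open CycleArithmetic n

  V : Set
  V = Fin n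

  n≡2 : n ≡ 2 mod 3
  n≡2 = trans (cong (λ t → (2 + t) % 3) (*-comm 3 k)) ([m+kn]%n≡m%n 2 k 3)

  n≤[1+k]*3 : n ≤ suc k * 3
  n≤[1+k]*3 = s≤s (s≤s (m≤n⇒m≤1+n (≤-reflexive (*-comm 3 k))))

  δ/3≤k : ∀ x v → δ x v / 3 ≤ k
  δ/3≤k x v = ≤-pred (m<n*o⇒m/o<n (<-≤-trans (δ<n x v) n≤[1+k]*3))

  δ<2+[b+[k∸b]]*3 : ∀ {b} → b ≤ k → ∀ x v → δ x v < 2 + (b + (k ∸ b)) * 3
  δ<2+[b+[k∸b]]*3 b≤k x v =
    subst (λ t → δ x v < 2 + t) (trans (*-comm 3 k) (cong (_* 3) (sym (m+[n∸m]≡n b≤k)))) (δ<n x v)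

  _∼_ : V → V → Set
  a ∼ b = δ a b ≡ 1 mod 3

  _∼?_ : ∀ a b → Dec (a ∼ b)
  a ∼? b = δ a b % 3 ℕ.≟ 1

  -- With the literal modulus 3, _%_ computes and hides its argument from unification,
  -- so the implicit arguments of the residue lemmas are supplied by hand below.
  ∼⇒≢ : ∀ a b → a ∼ b → a ≢ b
  ∼⇒≢ a b a∼b a≡b with trans (sym a∼b) (cong (_% 3) (≡⇒δ≡0 a≡b))
  ... | ()

  ∼-sym : ∀ a b → a ∼ b → b ∼ a
  ∼-sym a b a∼b = +-cancelˡ-mod {3} 1 {δ b a} {1} (begin
    (1 + δ b a) % 3      ≡⟨ +-cong-mod {3} {1} {δ a b} {δ b a} {δ b a} (sym a∼b) refl ⟩
    (δ a b + δ b a) % 3  ≡⟨ cong (_% 3) (δ+δ≡n (∼⇒≢ a b a∼b)) ⟩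
    n % 3                ≡⟨ n≡2 ⟩
    2 % 3                ∎)

  ∼-triangle-free : ∀ a b c → a ∼ b → b ∼ c → ¬ a ∼ c
  ∼-triangle-free a b c a∼b b∼c a∼c with δ-additive a b c
  ... | inj₁ no-wrap with (begin
    2 % 3                ≡⟨ +-cong-mod {3} {δ a b} {1} {δ b c} {1} a∼b b∼c ⟨
    (δ a b + δ b c) % 3  ≡⟨ cong (_% 3) no-wrap ⟩
    δ a c % 3            ≡⟨ a∼c ⟩
    1 % 3                ∎)
  ...   | ()
  ∼-triangle-free a b c a∼b b∼c a∼c | inj₂ wrap with (begin
    2 % 3                ≡⟨ +-cong-mod {3} {δ a b} {1} {δ b c} {1} a∼b b∼c ⟨
    (δ a b + δ b c) % 3  ≡⟨ cong (_% 3) wrap ⟩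
    (n + δ a c) % 3      ≡⟨ +-cong-mod {3} {n} {2} {δ a c} {1} n≡2 a∼c ⟩
    3 % 3                ∎)
  ...   | ()

  D₁ : V → ℕ → List V
  D₁ x b = map (x ⊕_) (offsets₁ b (k ∸ b))

  D₂ : V → ℕ → List V
  D₂ z b = map (z ⊕_) (offsets₂ b (k ∸ b))

  length-D₁ : ∀ x {b} → b ≤ k → length (D₁ x b) ≡ k
  length-D₁ x {b} b≤k = begin
    length (D₁ x b)                  ≡⟨ length-map (x ⊕_) (offsets₁ b (k ∸ b)) ⟩
    length (offsets₁ b (k ∸ b))      ≡⟨ length-offsets₁ b (k ∸ b) ⟩
    b + (k ∸ b)                      ≡⟨ m+[n∸m]≡n b≤k ⟩
    k                                ∎

  length-D₂ : ∀ z {b} → b ≤ k → length (D₂ z b) ≡ suc k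
  length-D₂ z {b} b≤k = begin
    length (D₂ z b)                  ≡⟨ length-map (z ⊕_) (offsets₂ b (k ∸ b)) ⟩
    length (offsets₂ b (k ∸ b))      ≡⟨ length-offsets₂ b (k ∸ b) ⟩
    b + suc (k ∸ b)                  ≡⟨ +-suc b (k ∸ b) ⟩
    suc (b + (k ∸ b))                ≡⟨ cong suc (m+[n∸m]≡n b≤k) ⟩
    suc k                            ∎

  D₁-dominates : ∀ x {b} → b ≤ k → ∀ v → v ≢ x → v ≢ x ⊕ suc (b * 3)
               → DominatedBy (Cycle n) (D₁ x b) v
  D₁-dominates x {b} b≤k v v≢x v≢hole = ⊕-dominates x (offsets₁ b (k ∸ b)) v
    (offsets₁-covers b (k ∸ b) (δ x v) 0<δ (δ<2+[b+[k∸b]]*3 b≤k x v) δ≢hole)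
    where
    0<δ : 0 < δ x v
    0<δ = n≢0⇒n>0 (v≢x ∘ sym ∘ δ≡0⇒≡)
    δ≢hole : δ x v ≢ suc (b * 3)
    δ≢hole δ≡hole = v≢hole (trans (sym (⊕-δ x v)) (cong (x ⊕_) δ≡hole))

  D₂-dominates : ∀ z {b} → b ≤ k → ∀ w → w ≢ z ⊎ b ≡ 0 → DominatedBy (Cycle n) (D₂ z b) w
  D₂-dominates z {b} b≤k w w≢z⊎b≡0 = ⊕-dominates z (offsets₂ b (k ∸ b)) w
    (offsets₂-covers b (k ∸ b) (δ z w) (0<δ w≢z⊎b≡0) (δ<2+[b+[k∸b]]*3 b≤k z w))
    where
    0<δ : w ≢ z ⊎ b ≡ 0 → 0 < δ z w ⊎ b ≡ 0
    0<δ (inj₁ w≢z) = inj₁ (n≢0⇒n>0 (w≢z ∘ sym ∘ δ≡0⇒≡))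
    0<δ (inj₂ b≡0) = inj₂ b≡0

  ≡0⇒∈D₂[0] : ∀ z v → δ z v ≡ 0 mod 3 → v ∈ D₂ z 0
  ≡0⇒∈D₂[0] z v δ≡0 = ⊕-∈ z (offsets₂ 0 k) δ≡q*3 (∈-progression 0 (s≤s (δ/3≤k z v)))
    where
    δ≡q*3 : δ z v ≡ δ z v / 3 * 3
    δ≡q*3 = trans (m≡m%n+[m/n]*n (δ z v) 3) (cong (_+ δ z v / 3 * 3) δ≡0)

  ≡2-<-≡0⇒∈D₂ : ∀ z x y → δ z x ≡ 2 mod 3 → δ z y ≡ 0 mod 3 → δ z x < δ z y
              → ∃[ b ] (b ≤ k × x ∈ D₂ z b × y ∈ D₂ z b)
  ≡2-<-≡0⇒∈D₂ z x y δx≡2 δy≡0 δx<δy =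
    b , δ/3≤k z y , ⊕-∈ z (offsets₂ b (k ∸ b)) δx≡ (∈-++⁺ˡ (∈-progression 2 a<b))
                  , ⊕-∈ z (offsets₂ b (k ∸ b)) δy≡ (∈-++⁺ʳ (progression 2 b) (here refl))
    where
    a b : ℕ
    a = δ z x / 3
    b = δ z y / 3
    δx≡ : δ z x ≡ 2 + a * 3
    δx≡ = trans (m≡m%n+[m/n]*n (δ z x) 3) (cong (_+ a * 3) δx≡2)
    δy≡ : δ z y ≡ b * 3
    δy≡ = trans (m≡m%n+[m/n]*n (δ z y) 3) (cong (_+ b * 3) δy≡0)
    a<b : a < b
    a<b = *-cancelʳ-< 3 a b (≤-<-trans (m≤n+m (a * 3) 2) (subst₂ _<_ δx≡ δy≡ δx<δy))

  common-base₀ : ∀ p q → ¬ p ∼ q → ∃[ w ] (p ∈ D₂ w 0 × q ∈ D₂ w 0)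
  common-base₀ p q p≁q with ≢1⇒≡0⊎≡2 {δ p q} p≁q
  ... | inj₁ δpq≡0 = p , ≡0⇒∈D₂[0] p p (cong (_% 3) (δ-self p)) , ≡0⇒∈D₂[0] p q δpq≡0
  ... | inj₂ δpq≡2 = q , ≡0⇒∈D₂[0] q p δqp≡0 , ≡0⇒∈D₂[0] q q (cong (_% 3) (δ-self q))
    where
    p≢q : p ≢ q
    p≢q p≡q with trans (sym δpq≡2) (cong (_% 3) (≡⇒δ≡0 p≡q))
    ... | ()
    δqp≡0 : δ q p ≡ 0 mod 3
    δqp≡0 = +-cancelˡ-mod {3} 2 {δ q p} {0} (begin
      (2 + δ q p) % 3      ≡⟨ +-cong-mod {3} {2} {δ p q} {δ q p} {δ q p} (sym δpq≡2) refl ⟩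
      (δ p q + δ q p) % 3  ≡⟨ cong (_% 3) (δ+δ≡n p≢q) ⟩
      n % 3                ≡⟨ n≡2 ⟩
      2 % 3                ∎)

  -- Going from z, the pair p ∼ q is met either as p then q, at distances ≡ 2 and ≡ 0,
  -- or, wrapping around, as q then p, at distances ≡ 2 and ≡ 0 again.
  common-base : ∀ z p q → p ∼ q → ¬ z ∼ p → ¬ z ∼ q → ∃[ b ] (b ≤ k × p ∈ D₂ z b × q ∈ D₂ z b)
  common-base z p q p∼q z≁p z≁q with δ-additive z p q | ≢1⇒≡0⊎≡2 {δ z p} z≁p
  ... | inj₁ no-wrap | inj₁ δzp≡0 = ⊥-elim (z≁q (begin
    δ z q % 3            ≡⟨ cong (_% 3) no-wrap ⟨
    (δ z p + δ p q) % 3  ≡⟨ +-cong-mod {3} {δ z p} {0} {δ p q} {1} δzp≡0 p∼q ⟩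
    1 % 3                ∎))
  ... | inj₁ no-wrap | inj₂ δzp≡2 = ≡2-<-≡0⇒∈D₂ z p q δzp≡2 δzq≡0 δzp<δzq
    where
    δzq≡0 : δ z q ≡ 0 mod 3
    δzq≡0 = begin
      δ z q % 3            ≡⟨ cong (_% 3) no-wrap ⟨
      (δ z p + δ p q) % 3  ≡⟨ +-cong-mod {3} {δ z p} {2} {δ p q} {1} δzp≡2 p∼q ⟩
      3 % 3                ∎
    δzp<δzq : δ z p < δ z q
    δzp<δzq = subst (δ z p <_) no-wrap (m<m+n (δ z p) (n≢0⇒n>0 (∼⇒≢ p q p∼q ∘ δ≡0⇒≡)))
  ... | inj₂ wrap | inj₁ δzp≡0 =
    let b , b≤k , q∈ , p∈ = ≡2-<-≡0⇒∈D₂ z q p δzq≡2 δzp≡0 δzq<δzp in b , b≤k , p∈ , q∈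
    where
    δzq≡2 : δ z q ≡ 2 mod 3
    δzq≡2 = +-cancelˡ-mod {3} 2 {δ z q} {2} (begin
      (2 + δ z q) % 3      ≡⟨ +-cong-mod {3} {n} {2} {δ z q} {δ z q} n≡2 refl ⟨
      (n + δ z q) % 3      ≡⟨ cong (_% 3) wrap ⟨
      (δ z p + δ p q) % 3  ≡⟨ +-cong-mod {3} {δ z p} {0} {δ p q} {1} δzp≡0 p∼q ⟩
      1 % 3                ∎)
    δzq<δzp : δ z q < δ z p
    δzq<δzp = +-cancelˡ-< n (δ z q) (δ z p)
      (subst₂ _<_ wrap (+-comm (δ z p) n) (+-monoʳ-< (δ z p) (δ<n p q)))
  ... | inj₂ wrap | inj₂ δzp≡2 = ⊥-elim (z≁q (+-cancelˡ-mod {3} 2 {δ z q} {1} (begin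
    (2 + δ z q) % 3      ≡⟨ +-cong-mod {3} {n} {2} {δ z q} {δ z q} n≡2 refl ⟨
    (n + δ z q) % 3      ≡⟨ cong (_% 3) wrap ⟨
    (δ z p + δ p q) % 3  ≡⟨ +-cong-mod {3} {δ z p} {2} {δ p q} {1} δzp≡2 p∼q ⟩
    3 % 3                ∎)))

  module _ {γ : ℕ} (isγ : IsDominationNumber (Functigraph (Cycle n) f) γ) where

    γ≤∣D₁∣+∣D₂∣ : ∀ x z b b′ → b ≤ k → b′ ≤ k → f x ∈ D₂ z b′ → f (x ⊕ suc (b * 3)) ∈ D₂ z b′
       → b′ ≡ 0 ⊎ z ∈ map f (D₁ x b) → γ ≤ k + suc k
    γ≤∣D₁∣+∣D₂∣ x z b b′ b≤k b′≤k fx∈ fhole∈ z-covered =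
      ≤-trans (functigraph-domination-≤ _≟ᶠ_ (Cycle n) f isγ (D₁ x b) (D₂ z b′) on-G₁ on-G₂)
              (≤-reflexive (cong₂ _+_ (length-D₁ x b≤k) (length-D₂ z b′≤k)))
      where
      on-G₁ : ∀ v → DominatedBy (Cycle n) (D₁ x b) v ⊎ f v ∈ D₂ z b′
      on-G₁ v with v ≟ᶠ x | v ≟ᶠ x ⊕ suc (b * 3)
      ... | yes refl | _ = inj₂ fx∈
      ... | no _ | yes refl = inj₂ fhole∈
      ... | no v≢x | no v≢hole = inj₁ (D₁-dominates x b≤k v v≢x v≢hole)

      on-G₂ : ∀ w → DominatedBy (Cycle n) (D₂ z b′) w ⊎ w ∈ map f (D₁ x b)
      on-G₂ w with w ≟ᶠ z
      ... | no w≢z = inj₁ (D₂-dominates z b′≤k w (inj₁ w≢z))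
      ... | yes refl = Sum.map₁ (D₂-dominates z b′≤k z ∘ inj₂) z-covered

    unrelated : ∀ x b → b ≤ k → ¬ f x ∼ f (x ⊕ suc (b * 3)) → γ ≤ k + suc k
    unrelated x b b≤k ≁ =
      let w , fx∈ , fhole∈ = common-base₀ (f x) (f (x ⊕ suc (b * 3))) ≁
      in γ≤∣D₁∣+∣D₂∣ x w b 0 b≤k z≤n fx∈ fhole∈ (inj₁ refl)

    c : V
    c = Fin.zero

    P : ℕ → V
    P i = f (c ⊕ i)

    unrelated-step : ∀ j → ¬ P j ∼ P (suc j) → γ ≤ k + suc k
    unrelated-step j ≁ = unrelated (c ⊕ j) 0 z≤n (≁ ∘ subst (λ y → P j ∼ f y) ⊕1≡)
      where
      ⊕1≡ : (c ⊕ j) ⊕ 1 ≡ c ⊕ suc j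
      ⊕1≡ = trans (⊕-assoc c j 1) (cong (c ⊕_) (+-comm j 1))

    related : 1 ≤ k → f c ∼ P 1 → P 1 ∼ P 2 → P 2 ∼ P 3 → P 3 ∼ P 4 → f c ∼ P 4 → γ ≤ k + suc k
    related 1≤k c∼1 1∼2 2∼3 3∼4 c∼4 =
      let b , b≤k , fc∈ , P1∈ = common-base (P 3) (f c) (P 1) c∼1 3≁c 3≁1
      in γ≤∣D₁∣+∣D₂∣ c (P 3) 0 b z≤n b≤k fc∈ P1∈ (inj₂ (∈-map⁺ f c⊕3∈D₁))
      where
      3≁c : ¬ P 3 ∼ f c
      3≁c 3∼c = ∼-triangle-free (f c) (P 4) (P 3) c∼4 (∼-sym (P 3) (P 4) 3∼4) (∼-sym (P 3) (f c) 3∼c)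
      3≁1 : ¬ P 3 ∼ P 1
      3≁1 3∼1 = ∼-triangle-free (P 1) (P 2) (P 3) 1∼2 2∼3 (∼-sym (P 3) (P 1) 3∼1)
      c⊕3∈D₁ : c ⊕ 3 ∈ D₁ c 0
      c⊕3∈D₁ = ∈-map⁺ (c ⊕_) (∈-progression 3 1≤k)

    γ≤2k+1 : 1 ≤ k → γ ≤ k + suc k
    γ≤2k+1 1≤k with f c ∼? P 1 | P 1 ∼? P 2 | P 2 ∼? P 3 | P 3 ∼? P 4 | f c ∼? P 4
    ... | no ≁ | _ | _ | _ | _ = unrelated c 0 z≤n ≁
    ... | yes _ | no ≁ | _ | _ | _ = unrelated-step 1 ≁
    ... | yes _ | yes _ | no ≁ | _ | _ = unrelated-step 2 ≁
    ... | yes _ | yes _ | yes _ | no ≁ | _ = unrelated-step 3 ≁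
    ... | yes _ | yes _ | yes _ | yes _ | no ≁ = unrelated c 1 1≤k ≁
    ... | yes c∼1 | yes 1∼2 | yes 2∼3 | yes 3∼4 | yes c∼4 = related 1≤k c∼1 1∼2 2∼3 3∼4 c∼4

theorem4p9 : (k : ℕ) → 1 ≤ k → (f : Fin (2 + 3 * k) → Fin (2 + 3 * k))
    → (a b : ℕ)
    → IsDominationNumber (Functigraph (Cycle (2 + 3 * k)) f) a
    → IsDominationNumber (Cycle (2 + 3 * k)) b
    → a < 2 * b
theorem4p9 k 1≤k f a b isγ ((D , _ , dominating , refl) , _) =
  ≤-trans (s≤s (Construction.γ≤2k+1 k f isγ 1≤k)) (+-mono-≤ k<b (m≤n⇒m≤n+o 0 k<b))
  where
  k<b : k < length D
  k<b = *-cancelʳ-< 3 k (length D)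
          (<-≤-trans (m<n+m (k * 3) {2} (s≤s z≤n))
                     (subst (_≤ length D * 3) (cong (2 +_) (*-comm 3 k))
                            (CycleArithmetic.cycle-domination-≥ (2 + 3 * k) D dominating)))
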